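{- Let $k$ be the finite field with $q$ elements ($q$ a prime power). For every integer $l\ge 0$, $$\#\mathcal A^l=\frac{q^l-(-1)^l}{q+1},\qquad \#\mathcal C^l=\frac{q^{l+1}+(-1)^l}{q+1}.$$
   Context: For a field $k$, let $F_k$ be the free monoid of all finite words $\alpha_1\cdots\alpha_l$ ($l\ge0$) with letters in $k$, and $F_k^l$ the words of length exactly $l$. For $\alpha\in k$ put $M_\alpha=\begin{pmatrix}0&-1\\1&\alpha\end{pmatrix}$ and let $\pi(\alpha_1\cdots\alpha_l)=M_{\alpha_1}\cdots M_{\alpha_l}\in\mathrm{SL}_2(k)$ (identity for the empty word). Let $\mathcal A$ be the set of words $w$ with $\pi(w)$ having lower-right entry $0$ (equivalently $\pi(w)=\begin{pmatrix}a&-b\\ b^{ -1}&0\end{pmatrix}$, $a\in k$, $b\in k^*$), $\mathcal C=F_k\setminus\mathcal A$, $\mathcal A^l=\mathcal A\cap F_k^l$, $\mathcal C^l=\mathcal C\cap F_k^l$. -}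

module Defs where

open import Data.Nat using (ℕ)
open import Data.Vec using (Vec; []; _∷_)
open import Data.Product using (Σ; ∃)
open import Relation.Binary.PropositionalEquality using (_≡_)
open import Relation.Nullary using (¬_)
open import Algebra.Structures using (IsCommutativeRing)

record Field : Set₁ where
  infixl 7 _*_
  infixl 6 _+_
  field
    Carrier : Set
    _+_ _*_ : Carrier → Carrier → Carrier
    -_ : Carrier → Carrier
    0# 1# : Carrier
    isCommutativeRing : IsCommutativeRing _≡_ _+_ _*_ -_ 0# 1#
    1≢0 : ¬ (1# ≡ 0#)
    inverse : ∀ x → ¬ (x ≡ 0#) → ∃ λ y → x * y ≡ 1#

module _ (K : Field) where
  open Field K

  record Mat2 : Set where
    constructor mat
    field
      a11 a12 a21 a22 : Carrier

  _·_ : Mat2 → Mat2 → Mat2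
  mat a b c d · mat a' b' c' d' =
    mat (a * a' + b * c') (a * b' + b * d') (c * a' + d * c') (c * b' + d * d')

  I₂ : Mat2
  I₂ = mat 1# 0# 0# 1#

  M : Carrier → Mat2
  M α = mat 0# (- 1#) 1# α

  π : ∀ {l} → Vec Carrier l → Mat2
  π [] = I₂
  π (α ∷ w) = M α · π w

  lowerRight : Mat2 → Carrier
  lowerRight = Mat2.a22

  𝒜 : ℕ → Set
  𝒜 l = Σ (Vec Carrier l) (λ w → lowerRight (π w) ≡ 0#)

  𝒞 : ℕ → Set
  𝒞 l = Σ (Vec Carrier l) (λ w → ¬ (lowerRight (π w) ≡ 0#))

-- Reading a word from the left, π(αw) = M_α π(w) has right column
-- (−d, b + αd) when π(w) has right column (b, d), and (b, d) ≠ (0, 0).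
-- Hence αw ∈ 𝒜 iff b + αd = 0: if w ∈ 𝒞 (d ≠ 0) there is exactly one such α,
-- and if w ∈ 𝒜 there is none.  So #𝒜^{l+1} = #𝒞^l and
-- #𝒞^{l+1} = q·#𝒜^l + (q−1)·#𝒞^l, and the closed forms follow by induction.
module Submission where

open import Defs
open import Data.Nat using (ℕ; zero; suc) renaming (_+_ to _+ℕ_; _*_ to _*ℕ_)
open import Data.Fin as Fin using (Fin; punchIn; punchOut)
open import Data.Fin.Properties
  using (+↔⊎; *↔×; inj⇒≟; punchOut-cong; punchOut-punchIn; punchIn-punchOut; punchInᵢ≢i)
open import Data.Vec using (Vec; []; _∷_)
open import Data.Product using (Σ; _×_; _,_; proj₁; proj₂)
open import Data.Product.Properties using (Σ-≡,≡→≡)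
open import Data.Product.Function.Dependent.Propositional using (congˡ)
import Data.Product.Function.Dependent.Propositional as Σ
open import Data.Product.Function.NonDependent.Propositional using (_×-↔_)
open import Data.Sum using (_⊎_; inj₁; inj₂; [_,_]′)
open import Data.Sum.Function.Propositional using (_⊎-↔_)
open import Data.Empty using (⊥-elim)
open import Function.Base using (_∘_)
open import Function.Bundles using (_↔_; _⇔_; Inverse; Equivalence; mk↔ₛ′; mk⇔)
open import Function.Properties.Inverse using (↔-refl; ↔-sym; ↔-trans; ↔⇒↣)
open import Function.Related.Propositional using (module EquationalReasoning)
open import Function.Related.TypeIsomorphisms using (Σ-distribʳ-⊎)
open import Algebra.Bundles using (Ring)
open import Algebra.Structures using (IsCommutativeRing)
import Algebra.Properties.Ring as RingProperties
open import Relation.Nullary using (¬_; Dec; yes; no)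
open import Relation.Unary using (Decidable; Irrelevant; ∁)
open import Relation.Binary.PropositionalEquality
open import Relation.Binary.PropositionalEquality.WithK using (≡-irrelevant)

private
  variable
    A B : Set
    m n : ℕ

⊎↔Fin+ : A ↔ Fin m → B ↔ Fin n → (A ⊎ B) ↔ Fin (m +ℕ n)
⊎↔Fin+ A↔m B↔n = ↔-trans (A↔m ⊎-↔ B↔n) (↔-sym +↔⊎)

Σ↔Fin* : {P : A → Set} → A ↔ Fin m → (∀ a → P a ↔ Fin n) → Σ A P ↔ Fin (m *ℕ n)
Σ↔Fin* A↔m P↔n = ↔-trans (congˡ (λ {a} → P↔n a)) (↔-trans (A↔m ×-↔ ↔-refl) (↔-sym *↔×))

Σ⊎Σ∁↔ : {P : A → Set} → Decidable P → Irrelevant P → (Σ A P ⊎ Σ A (∁ P)) ↔ A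
Σ⊎Σ∁↔ {A = A} {P} P? P-irr = mk↔ₛ′ [ proj₁ , proj₁ ]′ split split-from from-split
  where
  classify : ∀ a → Dec (P a) → Σ A P ⊎ Σ A (∁ P)
  classify a (yes p) = inj₁ (a , p)
  classify a (no ¬p) = inj₂ (a , ¬p)

  split : A → Σ A P ⊎ Σ A (∁ P)
  split a = classify a (P? a)

  split-from : ∀ a → [ proj₁ , proj₁ ]′ (split a) ≡ a
  split-from a with P? a
  ... | yes _ = refl
  ... | no _  = refl

  from-split : ∀ s → split ([ proj₁ , proj₁ ]′ s) ≡ s
  from-split (inj₁ (a , p)) with P? a
  ... | yes p′ = cong (λ p → inj₁ (a , p)) (P-irr p′ p)
  ... | no ¬p  = ⊥-elim (¬p p)
  from-split (inj₂ (a , ¬p)) with P? a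
  ... | yes p = ⊥-elim (¬p p)
  ... | no _  = refl

-- Proofs of negations are definitionally equal (⊥ is a record with an
-- irrelevant field), so round trips through Σ A (∁ P) hold by refl here and below.
Σ∁↔-empty : {P : A → Set} → (∀ a → ¬ P a) → Σ A (∁ P) ↔ A
Σ∁↔-empty ¬P = mk↔ₛ′ proj₁ (λ a → a , ¬P a) (λ _ → refl) (λ _ → refl)

Σ∁↔Fin-singleton : {P : A → Set} → A ↔ Fin (suc n) → (a : A) → (∀ {b} → P b ⇔ b ≡ a)
                 → Σ A (∁ P) ↔ Fin n
Σ∁↔Fin-singleton {A = A} {n} {P} A↔Fin a P⇔≡a = mk↔ₛ′ to from to∘from from∘to
  where
  open Inverse A↔Fin renaming (to to f; from to g)

  injective : ∀ {b c} → f b ≡ f c → b ≡ c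
  injective {b} {c} fb≡fc = begin
    b       ≡⟨ strictlyInverseʳ b ⟨
    g (f b) ≡⟨ cong g fb≡fc ⟩
    g (f c) ≡⟨ strictlyInverseʳ c ⟩
    c       ∎
    where open ≡-Reasoning

  to : Σ A (∁ P) → Fin n
  to (b , ¬Pb) = punchOut {i = f a} {j = f b}
    (λ fa≡fb → ¬Pb (Equivalence.from P⇔≡a (sym (injective fa≡fb))))

  from : Fin n → Σ A (∁ P)
  from k = g (punchIn (f a) k) , λ Pgk →
    punchInᵢ≢i (f a) k (trans (sym (strictlyInverseˡ _)) (cong f (Equivalence.to P⇔≡a Pgk)))

  to∘from : ∀ k → to (from k) ≡ k
  to∘from k = trans (punchOut-cong (f a) (strictlyInverseˡ (punchIn (f a) k))) (punchOut-punchIn (f a))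

  from∘to : ∀ s → from (to s) ≡ s
  from∘to (b , _) = ≡-Σ∁ (trans (cong g (punchIn-punchOut _)) (strictlyInverseʳ b))
    where
    ≡-Σ∁ : ∀ {b c} {¬Pb : ¬ P b} {¬Pc : ¬ P c} → b ≡ c → _≡_ {A = Σ A (∁ P)} (b , ¬Pb) (c , ¬Pc)
    ≡-Σ∁ refl = refl

module _ (K : Field) where
  open Field K
  open IsCommutativeRing isCommutativeRing
    using (isRing; *-identityˡ; *-identityʳ; *-assoc; *-comm; +-identityˡ; +-identityʳ; zeroˡ; zeroʳ; -‿inverseʳ)

  ring : Ring _ _
  ring = record { isRing = isRing }

  open RingProperties ring using (-1*x≈-x; -‿injective; -0#≈0#; +-inverseʳ-unique)
  open ≡-Reasoning

  b d : ∀ {l} → Vec Carrier l → Carrier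
  b w = Mat2.a12 (π K w)
  d w = lowerRight K (π K w)

  b-∷ : ∀ {l} α (w : Vec Carrier l) → b (α ∷ w) ≡ - d w
  b-∷ α w = begin
    0# * b w + - 1# * d w ≡⟨ cong₂ _+_ (zeroˡ (b w)) (-1*x≈-x (d w)) ⟩
    0# + - d w            ≡⟨ +-identityˡ (- d w) ⟩
    - d w                 ∎

  d-∷ : ∀ {l} α (w : Vec Carrier l) → d (α ∷ w) ≡ b w + α * d w
  d-∷ α w = cong (_+ α * d w) (*-identityˡ (b w))

  d≡0⇒d-∷≡b : ∀ {l} α (w : Vec Carrier l) → d w ≡ 0# → d (α ∷ w) ≡ b w
  d≡0⇒d-∷≡b α w dw≡0 = begin
    d (α ∷ w)      ≡⟨ d-∷ α w ⟩
    b w + α * d w  ≡⟨ cong (λ x → b w + α * x) dw≡0 ⟩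
    b w + α * 0#   ≡⟨ cong (b w +_) (zeroʳ α) ⟩
    b w + 0#       ≡⟨ +-identityʳ (b w) ⟩
    b w            ∎

  rightColumn-nonzero : ∀ {l} (w : Vec Carrier l) → b w ≡ 0# → d w ≢ 0#
  rightColumn-nonzero []      _      = 1≢0
  rightColumn-nonzero (α ∷ w) bαw≡0 dαw≡0 = rightColumn-nonzero w bw≡0 dw≡0
    where
    dw≡0 : d w ≡ 0#
    dw≡0 = -‿injective (trans (trans (sym (b-∷ α w)) bαw≡0) (sym -0#≈0#))
    bw≡0 : b w ≡ 0#
    bw≡0 = trans (sym (d≡0⇒d-∷≡b α w dw≡0)) dαw≡0

  d≡0⇒d-∷≢0 : ∀ {l} α (w : Vec Carrier l) → d w ≡ 0# → d (α ∷ w) ≢ 0#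
  d≡0⇒d-∷≢0 α w dw≡0 dαw≡0 = rightColumn-nonzero w (trans (sym (d≡0⇒d-∷≡b α w dw≡0)) dαw≡0) dw≡0

  module _ {y : Carrier} (y≢0 : y ≢ 0#) where
    private
      y⁻¹ : Carrier
      y⁻¹ = proj₁ (inverse y y≢0)

      y*y⁻¹≡1 : y * y⁻¹ ≡ 1#
      y*y⁻¹≡1 = proj₂ (inverse y y≢0)

    root : Carrier → Carrier
    root x = - x * y⁻¹

    root-solves : ∀ x → x + root x * y ≡ 0#
    root-solves x = begin
      x + - x * y⁻¹ * y    ≡⟨ cong (x +_) (*-assoc (- x) y⁻¹ y) ⟩
      x + - x * (y⁻¹ * y)  ≡⟨ cong (λ z → x + - x * z) (trans (*-comm y⁻¹ y) y*y⁻¹≡1) ⟩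
      x + - x * 1#         ≡⟨ cong (x +_) (*-identityʳ (- x)) ⟩
      x + - x              ≡⟨ -‿inverseʳ x ⟩
      0#                   ∎

    root-unique : ∀ {x α} → x + α * y ≡ 0# → α ≡ root x
    root-unique {x} {α} x+αy≡0 = begin
      α              ≡⟨ *-identityʳ α ⟨
      α * 1#         ≡⟨ cong (α *_) y*y⁻¹≡1 ⟨
      α * (y * y⁻¹)  ≡⟨ *-assoc α y y⁻¹ ⟨
      α * y * y⁻¹    ≡⟨ cong (_* y⁻¹) (+-inverseʳ-unique x (α * y) x+αy≡0) ⟩
      - x * y⁻¹      ∎

  𝒜-∷⇔root : ∀ {l} (w : Vec Carrier l) (dw≢0 : d w ≢ 0#) {α} → d (α ∷ w) ≡ 0# ⇔ α ≡ root dw≢0 (b w)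
  𝒜-∷⇔root w dw≢0 {α} = mk⇔
    (λ dαw≡0 → root-unique dw≢0 (trans (sym (d-∷ α w)) dαw≡0))
    (λ { refl → trans (d-∷ α w) (root-solves dw≢0 (b w)) })

  𝒜-suc↔𝒞 : ∀ l → 𝒜 K (suc l) ↔ 𝒞 K l
  𝒜-suc↔𝒞 l = mk↔ₛ′ to from (λ _ → refl) from∘to
    where
    to : 𝒜 K (suc l) → 𝒞 K l
    to (α ∷ w , dαw≡0) = w , λ dw≡0 → d≡0⇒d-∷≢0 α w dw≡0 dαw≡0

    from : 𝒞 K l → 𝒜 K (suc l)
    from (w , dw≢0) = root dw≢0 (b w) ∷ w , Equivalence.from (𝒜-∷⇔root w dw≢0) refl

    from∘to : ∀ s → from (to s) ≡ s
    from∘to (α ∷ w , dαw≡0) = Σ-≡,≡→≡ (cong (_∷ w) (sym α≡root) , ≡-irrelevant _ _)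
      where
      α≡root : α ≡ root (proj₂ (to (α ∷ w , dαw≡0))) (b w)
      α≡root = Equivalence.to (𝒜-∷⇔root w (proj₂ (to (α ∷ w , dαw≡0)))) dαw≡0

  extensions : ∀ {l} → Vec Carrier l → Set
  extensions w = Σ Carrier (∁ λ α → d (α ∷ w) ≡ 0#)

  𝒞-suc↔Σ-extensions : ∀ l → 𝒞 K (suc l) ↔ Σ (Vec Carrier l) extensions
  𝒞-suc↔Σ-extensions l = mk↔ₛ′ to from (λ _ → refl) from∘to
    where
    to : 𝒞 K (suc l) → Σ (Vec Carrier l) extensions
    to (α ∷ w , ¬𝒜) = w , α , ¬𝒜

    from : Σ (Vec Carrier l) extensions → 𝒞 K (suc l)
    from (w , α , ¬𝒜) = α ∷ w , ¬𝒜

    from∘to : ∀ s → from (to s) ≡ s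
    from∘to (α ∷ w , _) = refl

  extensions-𝒜↔Carrier : ∀ {l} (a : 𝒜 K l) → extensions (proj₁ a) ↔ Carrier
  extensions-𝒜↔Carrier (w , dw≡0) = Σ∁↔-empty (λ α → d≡0⇒d-∷≢0 α w dw≡0)

  extensions-𝒞↔Fin : ∀ {l n} → Carrier ↔ Fin (suc n) → (c : 𝒞 K l) → extensions (proj₁ c) ↔ Fin n
  extensions-𝒞↔Fin card (w , dw≢0) = Σ∁↔Fin-singleton card (root dw≢0 (b w)) (𝒜-∷⇔root w dw≢0)

-- Opened only now: its -_ would clash with the field negation above.
open import Data.Integer using (ℤ; +_; -_; _-_) renaming (_+_ to _+ℤ_; _*_ to _*ℤ_; _^_ to _^ℤ_)
open import Data.Integer.Properties using (pos-+; pos-*)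
open import Data.Integer.Tactic.RingSolver using (solve-∀)

closed-form-step : ∀ Q A C X s → A *ℤ (Q +ℤ + 1) ≡ X - s → C *ℤ (Q +ℤ + 1) ≡ Q *ℤ X +ℤ s
                 → (A *ℤ Q +ℤ C *ℤ (Q - + 1)) *ℤ (Q +ℤ + 1) ≡ Q *ℤ (Q *ℤ X) +ℤ (- + 1) *ℤ s
closed-form-step Q A C X s hA hC = begin
  (A *ℤ Q +ℤ C *ℤ (Q - + 1)) *ℤ (Q +ℤ + 1)                 ≡⟨ regroup Q A C ⟩
  Q *ℤ (A *ℤ (Q +ℤ + 1)) +ℤ (Q - + 1) *ℤ (C *ℤ (Q +ℤ + 1)) ≡⟨ cong₂ (λ a c → Q *ℤ a +ℤ (Q - + 1) *ℤ c) hA hC ⟩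
  Q *ℤ (X - s) +ℤ (Q - + 1) *ℤ (Q *ℤ X +ℤ s)               ≡⟨ collapse Q X s ⟩
  Q *ℤ (Q *ℤ X) +ℤ (- + 1) *ℤ s                            ∎
  where
  open ≡-Reasoning
  regroup : ∀ Q A C → (A *ℤ Q +ℤ C *ℤ (Q - + 1)) *ℤ (Q +ℤ + 1)
                    ≡ Q *ℤ (A *ℤ (Q +ℤ + 1)) +ℤ (Q - + 1) *ℤ (C *ℤ (Q +ℤ + 1))
  regroup = solve-∀
  collapse : ∀ Q X s → Q *ℤ (X - s) +ℤ (Q - + 1) *ℤ (Q *ℤ X +ℤ s) ≡ Q *ℤ (Q *ℤ X) +ℤ (- + 1) *ℤ s
  collapse = solve-∀

module _ (q′ : ℕ) where
  #𝒜 #𝒞 : ℕ → ℕ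
  #𝒜 zero    = 0
  #𝒜 (suc l) = #𝒞 l
  #𝒞 zero    = 1
  #𝒞 (suc l) = #𝒜 l *ℕ suc q′ +ℕ #𝒞 l *ℕ q′

  private
    Q : ℤ
    Q = + suc q′

  #𝒜-closed : ∀ l → + #𝒜 l *ℤ (Q +ℤ + 1) ≡ Q ^ℤ l - (- + 1) ^ℤ l
  #𝒞-closed : ∀ l → + #𝒞 l *ℤ (Q +ℤ + 1) ≡ Q ^ℤ suc l +ℤ (- + 1) ^ℤ l

  #𝒜-closed zero    = refl
  #𝒜-closed (suc l) = trans (#𝒞-closed l) (+≡-−1* (Q ^ℤ suc l) ((- + 1) ^ℤ l))
    where
    +≡-−1* : ∀ X s → X +ℤ s ≡ X - (- + 1) *ℤ s
    +≡-−1* = solve-∀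

  #𝒞-closed zero    = unit-case Q
    where
    unit-case : ∀ Q → + 1 *ℤ (Q +ℤ + 1) ≡ Q *ℤ + 1 +ℤ + 1
    unit-case = solve-∀
  #𝒞-closed (suc l) = trans (cong (_*ℤ (Q +ℤ + 1)) #𝒞-suc-ℤ)
    (closed-form-step Q (+ #𝒜 l) (+ #𝒞 l) (Q ^ℤ l) ((- + 1) ^ℤ l) (#𝒜-closed l) (#𝒞-closed l))
    where
    -- + q′ and Q - + 1 are equal by computation.
    #𝒞-suc-ℤ : + #𝒞 (suc l) ≡ + #𝒜 l *ℤ Q +ℤ + #𝒞 l *ℤ (Q - + 1)
    #𝒞-suc-ℤ = trans (pos-+ (#𝒜 l *ℕ suc q′) (#𝒞 l *ℕ q′))
                     (cong₂ _+ℤ_ (pos-* (#𝒜 l) (suc q′)) (pos-* (#𝒞 l) q′))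

module _ (K : Field) {q′ : ℕ} (card : Field.Carrier K ↔ Fin (suc q′)) where
  open Field K using (Carrier; 0#; 1≢0)

  𝒜↔Fin : ∀ l → 𝒜 K l ↔ Fin (#𝒜 q′ l)
  𝒞↔Fin : ∀ l → 𝒞 K l ↔ Fin (#𝒞 q′ l)

  𝒜↔Fin zero    = mk↔ₛ′ (λ { ([] , 1≡0) → ⊥-elim (1≢0 1≡0) }) (λ ()) (λ ())
                         (λ { ([] , 1≡0) → ⊥-elim (1≢0 1≡0) })
  𝒜↔Fin (suc l) = ↔-trans (𝒜-suc↔𝒞 K l) (𝒞↔Fin l)

  𝒞↔Fin zero    = mk↔ₛ′ (λ _ → Fin.zero) (λ _ → ε)
                         (λ { Fin.zero → refl ; (Fin.suc ()) }) (λ { ([] , _) → refl })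
    where
    ε : 𝒞 K 0
    ε = [] , 1≢0
  𝒞↔Fin (suc l) = begin
    𝒞 K (suc l)                                        ↔⟨ 𝒞-suc↔Σ-extensions K l ⟩
    Σ (Vec Carrier l) (extensions K)                   ↔⟨ Σ.cong (Σ⊎Σ∁↔ 𝒜? ≡-irrelevant) ↔-refl ⟨
    Σ (𝒜 K l ⊎ 𝒞 K l) (extensions K ∘ [ proj₁ , proj₁ ]′)  ↔⟨ Σ-distribʳ-⊎ ⟩
    (Σ (𝒜 K l) (extensions K ∘ proj₁) ⊎ Σ (𝒞 K l) (extensions K ∘ proj₁))
      ↔⟨ ⊎↔Fin+ (Σ↔Fin* (𝒜↔Fin l) (λ a → ↔-trans (extensions-𝒜↔Carrier K a) card))
                 (Σ↔Fin* (𝒞↔Fin l) (extensions-𝒞↔Fin K card)) ⟩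
    Fin (#𝒞 q′ (suc l))                                ∎
    where
    open EquationalReasoning
    𝒜? : Decidable (λ w → d K w ≡ 0#)
    𝒜? w = inj⇒≟ (↔⇒↣ card) (d K w) 0#

corollary2p3 : (K : Field) (q : ℕ) → (Field.Carrier K ↔ Fin q) → (l : ℕ)
    → (Σ ℕ λ a → (𝒜 K l ↔ Fin a) × ((+ a) *ℤ (+ q +ℤ + 1) ≡ (+ q) ^ℤ l - (- + 1) ^ℤ l))
      × (Σ ℕ λ c → (𝒞 K l ↔ Fin c) × ((+ c) *ℤ (+ q +ℤ + 1) ≡ (+ q) ^ℤ (suc l) +ℤ (- + 1) ^ℤ l))
corollary2p3 K zero     card l with Inverse.to card (Field.0# K)
... | ()
corollary2p3 K (suc q′) card l =
  (#𝒜 q′ l , 𝒜↔Fin K card l , #𝒜-closed q′ l) , (#𝒞 q′ l , 𝒞↔Fin K card l , #𝒞-closed q′ l)
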